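{- (1) If $x^L:\langle\Gamma\vdash U\rangle$, then $\Gamma=(x^L:V)$ for some $V$ with $V\sqsubseteq U$. (2) If $\lambda x^L.M:\langle\Gamma\vdash U\rangle$, $x^L\in\mathrm{fv}(M)$ and $d(U)=K$, then $U=\omega^K$ or $U=\sqcap_{i=1}^p\vec e_K(V_i\to T_i)$ where $p\ge1$ and for all $i\in\{1,\dots,p\}$, $M:\langle\Gamma,x^L:\vec e_KV_i\vdash\vec e_KT_i\rangle$. (3) If $\lambda x^L.M:\langle\Gamma\vdash U\rangle$, $x^L\notin\mathrm{fv}(M)$ and $d(U)=K$, then $U=\omega^K$ or $U=\sqcap_{i=1}^p\vec e_K(V_i\to T_i)$ where $p\ge1$ and for all $i\in\{1,\dots,p\}$, $M:\langle\Gamma\vdash\vec e_KT_i\rangle$. (4) If $M\,x^L:\langle\Gamma,(x^L:U)\vdash T\rangle$ and $x^L\notin\mathrm{fv}(M)$, then $M:\langle\Gamma\vdash U\to T\rangle$.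
   Context: Indexes: finite sequences of natural numbers ($\mathcal L_{\mathbb N}$), $\oslash$ empty, $i::L$ prepending $i$, $L_1\preceq L_2$ (also $L_2\succeq L_1$) iff $L_2=L_1::L_3$ for some $L_3$ (concatenation). Terms: over a countably infinite set $\mathcal V$, terms $\mathcal M$, free indexed variables $\mathrm{fv}$, degree $d$, joinability $\diamond$ defined simultaneously: $x^L\in\mathcal M$ ($\mathrm{fv}=\{x^L\}$, $d=L$); $MN\in\mathcal M$ when $d(M)\preceq d(N)$, $M\diamond N$ ($\mathrm{fv}$ union, $d(MN)=d(M)$); $\lambda x^L.M\in\mathcal M$ when $L\succeq d(M)$ ($\mathrm{fv}(M)\setminus\{x^L\}$, $d=d(M)$). $M\diamond N$ iff $x^L\in\mathrm{fv}(M)$, $x^K\in\mathrm{fv}(N)$ imply $L=K$. Terms modulo $\alpha$. Lifting $(x^L)^{+i}=x^{i::L}$, $(M_1M_2)^{+i}=M_1^{+i}M_2^{+i}$, $(\lambda x^L.M)^{+i}=\lambda x^{i::L}.M^{+i}$. Types: atomic types $\mathcal A$, expansion variables $\overline e_0,\overline e_1,\dots$; $\mathbb T\subseteq\mathbb U$ with degree: $a\in\mathbb T$ ($d=\oslash$); $U\to T\in\mathbb T$ for $U\in\mathbb U,T\in\mathbb T$ ($d=\oslash$); $\omega^L\in\mathbb U$ ($d=L$); $U_1\sqcap U_2$ if $d(U_1)=d(U_2)$; $\overline e_iU$ ($d=i::d(U)$); modulo $\sqcap$ commutative, associative, idempotent, $\overline e_i(U_1\sqcap U_2)=\overline e_iU_1\sqcap\overline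 e_iU_2$, $\omega^L\sqcap U=U$ ($d(U)=L$), $\overline e_i\omega^K=\omega^{i::K}$. For $K=(i_1,\dots,i_n)$, $\vec e_KU$ denotes $\overline e_{i_1}\cdots\overline e_{i_n}U$; $\sqcap_{i=1}^pU_i=U_1\sqcap\dots\sqcap U_p$. Environments: finite sets of declarations $x^L:U$ (at most one per $x^L$); $\Gamma,\Delta$ disjoint union; $env^\omega_M$ assigns $\omega^L$ to each $x^L\in\mathrm{fv}(M)$; $\Gamma_1\sqcap\Gamma_2$ intersects types of common variables, keeps others; $\overline e_j\Gamma$ replaces $x^L:U$ by $x^{j::L}:\overline e_jU$; $\Gamma_1\diamond\Gamma_2$ iff $x^L\in\mathrm{dom}\,\Gamma_1$, $x^K\in\mathrm{dom}\,\Gamma_2$ imply $L=K$. Subtyping $\sqsubseteq$: least relation on types, environments and typings closed under reflexivity, transitivity, $U_1\sqcap U_2\sqsubseteq U_1$ ($d(U_1)=d(U_2)$), $U_1\sqcap U_2\sqsubseteq V_1\sqcap V_2$ if $U_i\sqsubseteq V_i$, $U_1\to T_1\sqsubseteq U_2\to T_2$ if $U_2\sqsubseteq U_1$, $T_1\sqsubseteq T_2$, $\overline e_iU_1\sqsubseteq\overline e_iU_2$ if $U_1\sqsubseteq U_2$, $\Gamma,y^L:U_1\sqsubseteq\Gamma,y^L:U_2$ if $U_1\sqsubseteq U_2$, $\langle\Gamma_1\vdash U_1\rangle\sqsubseteq\langle\Gamma_2\vdash U_2\rangle$ if $U_1\sqsubseteq U_2$, $\Gamma_2\sqsubseteq\Gamma_1$.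 Typing rules ($T\in\mathbb T$): (ax) $x^\oslash:\langle(x^\oslash:T)\vdash T\rangle$; ($\omega$) $M:\langle env^\omega_M\vdash\omega^{d(M)}\rangle$; ($\to_I$) $M:\langle\Gamma,(x^L:U)\vdash T\rangle\Rightarrow\lambda x^L.M:\langle\Gamma\vdash U\to T\rangle$; ($\to'_I$) $M:\langle\Gamma\vdash T\rangle$, $x^L\notin\mathrm{dom}\,\Gamma\Rightarrow\lambda x^L.M:\langle\Gamma\vdash\omega^L\to T\rangle$; ($\to_E$) $M_1:\langle\Gamma_1\vdash U\to T\rangle$, $M_2:\langle\Gamma_2\vdash U\rangle$, $\Gamma_1\diamond\Gamma_2\Rightarrow M_1M_2:\langle\Gamma_1\sqcap\Gamma_2\vdash T\rangle$; ($\sqcap_I$) $M:\langle\Gamma\vdash U_1\rangle$, $M:\langle\Gamma\vdash U_2\rangle\Rightarrow M:\langle\Gamma\vdash U_1\sqcap U_2\rangle$; ($e$) $M:\langle\Gamma\vdash U\rangle\Rightarrow M^{+j}:\langle\overline e_j\Gamma\vdash\overline e_jU\rangle$; ($\sqsubseteq$) $M:\langle\Gamma\vdash U\rangle$, $\langle\Gamma\vdash U\rangle\sqsubseteq\langle\Gamma'\vdash U'\rangle\Rightarrow M:\langle\Gamma'\vdash U'\rangle$. -}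

module Defs where

open import Data.Nat using (ℕ; zero; suc)
import Data.Nat as Nat
open import Data.List using (List; []; _∷_; _++_; filter)
import Data.List.Properties as ListP
open import Data.List.Membership.Propositional using (_∈_)
open import Data.Fin using (Fin; zero; suc)
open import Data.Maybe using (Maybe; just; nothing; Is-just)
import Data.Maybe as Maybe
open import Data.Maybe.Relation.Binary.Pointwise using (Pointwise)
open import Data.Product using (Σ; ∃; _×_; _,_; proj₁; proj₂)
import Data.Product.Properties as ProdP
open import Data.Bool using (if_then_else_)
open import Relation.Nullary using (¬_; does; ¬?)
open import Relation.Binary.PropositionalEquality using (_≡_)
open import Relation.Binary.Definitions using (DecidableEquality)

Index : Set
Index = List ℕ

_⪯_ : Index → Index → Set
L₁ ⪯ L₂ = Σ Index λ L₃ → L₂ ≡ L₁ ++ L₃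

-- Terms (raw syntax; variables 𝒱 = ℕ; an indexed variable x^L is (x , L))

IVar : Set
IVar = ℕ × Index

_≟IV_ : DecidableEquality IVar
_≟IV_ = ProdP.≡-dec Nat._≟_ (ListP.≡-dec Nat._≟_)

data Term : Set where
  var : ℕ → Index → Term
  app : Term → Term → Term
  lam : ℕ → Index → Term → Term

fv : Term → List IVar
fv (var x L)   = (x , L) ∷ []
fv (app M N)   = fv M ++ fv N
fv (lam x L M) = filter (λ w → ¬? (w ≟IV (x , L))) (fv M)

d : Term → Index
d (var x L)   = L
d (app M N)   = d M
d (lam x L M) = d M

_⋄_ : Term → Term → Set
M ⋄ N = ∀ x L K → (x , L) ∈ fv M → (x , K) ∈ fv N → L ≡ K

data WF : Term → Set where
  wf-var : ∀ {x L} → WF (var x L)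
  wf-app : ∀ {M N} → WF M → WF N → d M ⪯ d N → M ⋄ N → WF (app M N)
  wf-lam : ∀ {x L M} → WF M → d M ⪯ L → WF (lam x L M)

lift : ℕ → Term → Term
lift i (var x L)   = var x (i ∷ L)
lift i (app M N)   = app (lift i M) (lift i N)
lift i (lam x L M) = lam x (i ∷ L) (lift i M)

-- Types, intrinsically well formed: TyU L is the set of types U ∈ 𝕌 with
-- d(U) = L; TyT is 𝕋 (degree ∅).  Atomic types 𝒜 = ℕ.

data TyU : Index → Set
data TyT : Set

data TyT where
  atom : ℕ → TyT
  _⇒_  : ∀ {L} → TyU L → TyT → TyT

data TyU where
  embed : TyT → TyU []
  ω     : (L : Index) → TyU L
  _⊓_   : ∀ {L} → TyU L → TyU L → TyU L
  ē     : ∀ {L} (i : ℕ) → TyU L → TyU (i ∷ L)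

infixr 7 _⇒_
infixr 6 _⊓_

data _≈U_ : ∀ {L} → TyU L → TyU L → Set
data _≈T_ : TyT → TyT → Set

data _≈T_ where
  ≈T-refl  : ∀ {T} → T ≈T T
  ≈T-sym   : ∀ {T T'} → T ≈T T' → T' ≈T T
  ≈T-trans : ∀ {T₁ T₂ T₃} → T₁ ≈T T₂ → T₂ ≈T T₃ → T₁ ≈T T₃
  ≈T-⇒     : ∀ {L} {U U' : TyU L} {T T'} → U ≈U U' → T ≈T T' → (U ⇒ T) ≈T (U' ⇒ T')

data _≈U_ where
  ≈-refl   : ∀ {L} {U : TyU L} → U ≈U U
  ≈-sym    : ∀ {L} {U V : TyU L} → U ≈U V → V ≈U U
  ≈-trans  : ∀ {L} {U V W : TyU L} → U ≈U V → V ≈U W → U ≈U W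
  ≈-comm   : ∀ {L} {U₁ U₂ : TyU L} → (U₁ ⊓ U₂) ≈U (U₂ ⊓ U₁)
  ≈-assoc  : ∀ {L} {U₁ U₂ U₃ : TyU L} → ((U₁ ⊓ U₂) ⊓ U₃) ≈U (U₁ ⊓ (U₂ ⊓ U₃))
  ≈-idem   : ∀ {L} {U : TyU L} → (U ⊓ U) ≈U U
  ≈-ē-⊓    : ∀ {L} {i} {U₁ U₂ : TyU L} → ē i (U₁ ⊓ U₂) ≈U (ē i U₁ ⊓ ē i U₂)
  ≈-ω-unit : ∀ {L} {U : TyU L} → (ω L ⊓ U) ≈U U
  ≈-ē-ω    : ∀ {K} {i} → ē i (ω K) ≈U ω (i ∷ K)
  ≈-⊓      : ∀ {L} {U₁ U₂ V₁ V₂ : TyU L} → U₁ ≈U V₁ → U₂ ≈U V₂ → (U₁ ⊓ U₂) ≈U (V₁ ⊓ V₂)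
  ≈-ē      : ∀ {L} {i} {U V : TyU L} → U ≈U V → ē i U ≈U ē i V
  ≈-embed  : ∀ {T T'} → T ≈T T' → embed T ≈U embed T'

ēU : ∀ {L} (K : Index) → TyU L → TyU (K ++ L)
ēU []      U = U
ēU (i ∷ K) U = ē i (ēU K U)

ēT : (K : Index) → TyT → TyU K
ēT []      T = embed T
ēT (i ∷ K) T = ē i (ēT K T)

-- ⊓_{i=1}^{p} U_i  with p = n + 1 ≥ 1
⋂ : ∀ {K} (n : ℕ) → (Fin (suc n) → TyU K) → TyU K
⋂ zero    f = f zero
⋂ (suc n) f = f zero ⊓ ⋂ n (λ i → f (suc i))

data _⊑_ : ∀ {L} → TyU L → TyU L → Set where
  ⊑-≈     : ∀ {L} {U V : TyU L} → U ≈U V → U ⊑ V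
  ⊑-trans : ∀ {L} {U V W : TyU L} → U ⊑ V → V ⊑ W → U ⊑ W
  ⊑-⊓ˡ    : ∀ {L} {U₁ U₂ : TyU L} → (U₁ ⊓ U₂) ⊑ U₁
  ⊑-⊓     : ∀ {L} {U₁ U₂ V₁ V₂ : TyU L} → U₁ ⊑ V₁ → U₂ ⊑ V₂ → (U₁ ⊓ U₂) ⊑ (V₁ ⊓ V₂)
  ⊑-⇒     : ∀ {L} {U₁ U₂ : TyU L} {T₁ T₂} → U₂ ⊑ U₁ → embed T₁ ⊑ embed T₂ →
            embed (U₁ ⇒ T₁) ⊑ embed (U₂ ⇒ T₂)
  ⊑-ē     : ∀ {L} {i} {U₁ U₂ : TyU L} → U₁ ⊑ U₂ → ē i U₁ ⊑ ē i U₂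

Entry : Set
Entry = Σ Index TyU

Env : Set
Env = IVar → Maybe Entry

_∈dom_ : IVar → Env → Set
v ∈dom Γ = Is-just (Γ v)

[_↦_] : IVar → Entry → Env
[ v ↦ u ] w = if does (w ≟IV v) then just u else nothing

-- Γ , (v : u)   (used together with the side condition Γ v ≡ nothing)
_,,_↦_ : Env → IVar → Entry → Env
(Γ ,, v ↦ u) w = if does (w ≟IV v) then just u else Γ w

envω : Term → Env
envω M (x , L) = if does (Data.List.Membership.DecPropositional._∈?_ _≟IV_ (x , L) (fv M))
                 then just (L , ω L) else nothing
  where import Data.List.Membership.DecPropositional

ēEnv : ℕ → Env → Env
ēEnv j Γ (x , [])    = nothing
ēEnv j Γ (x , k ∷ L) =
  if does (k Nat.≟ j)
  then Maybe.map (λ u → (j ∷ proj₁ u , ē j (proj₂ u))) (Γ (x , L))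
  else nothing

_⋄E_ : Env → Env → Set
Γ₁ ⋄E Γ₂ = ∀ x L K → (x , L) ∈dom Γ₁ → (x , K) ∈dom Γ₂ → L ≡ K

-- Γ₁ ⊓ Γ₂ as a (pointwise) relation: MeetEnv Γ₁ Γ₂ Γ  means  Γ = Γ₁ ⊓ Γ₂
data MeetEntry : Maybe Entry → Maybe Entry → Maybe Entry → Set where
  none  : MeetEntry nothing nothing nothing
  left  : ∀ {u} → MeetEntry (just u) nothing (just u)
  right : ∀ {u} → MeetEntry nothing (just u) (just u)
  both  : ∀ {L} {U₁ U₂ : TyU L} → MeetEntry (just (L , U₁)) (just (L , U₂)) (just (L , U₁ ⊓ U₂))

MeetEnv : Env → Env → Env → Set
MeetEnv Γ₁ Γ₂ Γ = ∀ v → MeetEntry (Γ₁ v) (Γ₂ v) (Γ v)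

data EntryLE : Entry → Entry → Set where
  le : ∀ {L} {U U' : TyU L} → U ⊑ U' → EntryLE (L , U) (L , U')

data EntryEq : Entry → Entry → Set where
  eq : ∀ {L} {U U' : TyU L} → U ≈U U' → EntryEq (L , U) (L , U')

_⊑E_ : Env → Env → Set
Γ ⊑E Γ' = ∀ v → Pointwise EntryLE (Γ v) (Γ' v)

_≈E_ : Env → Env → Set
Γ ≈E Γ' = ∀ v → Pointwise EntryEq (Γ v) (Γ' v)

data _∶⟨_⊢_⟩ : ∀ {K} → Term → Env → TyU K → Set where
  ax   : ∀ x (T : TyT) → var x [] ∶⟨ [ (x , []) ↦ ([] , embed T) ] ⊢ embed T ⟩
  ω-ty : ∀ {M} → WF M → M ∶⟨ envω M ⊢ ω (d M) ⟩
  →I   : ∀ {Γ x L M L'} {U : TyU L'} {T} →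
         Γ (x , L) ≡ nothing →
         M ∶⟨ Γ ,, (x , L) ↦ (L' , U) ⊢ embed T ⟩ →
         WF (lam x L M) →
         lam x L M ∶⟨ Γ ⊢ embed (U ⇒ T) ⟩
  →I'  : ∀ {Γ x L M T} →
         M ∶⟨ Γ ⊢ embed T ⟩ →
         Γ (x , L) ≡ nothing →
         WF (lam x L M) →
         lam x L M ∶⟨ Γ ⊢ embed (ω L ⇒ T) ⟩
  →E   : ∀ {Γ₁ Γ₂ Γ M₁ M₂ L} {U : TyU L} {T} →
         M₁ ∶⟨ Γ₁ ⊢ embed (U ⇒ T) ⟩ →
         M₂ ∶⟨ Γ₂ ⊢ U ⟩ →
         Γ₁ ⋄E Γ₂ →
         MeetEnv Γ₁ Γ₂ Γ →
         WF (app M₁ M₂) →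
         app M₁ M₂ ∶⟨ Γ ⊢ embed T ⟩
  ⊓I   : ∀ {Γ M K} {U₁ U₂ : TyU K} →
         M ∶⟨ Γ ⊢ U₁ ⟩ → M ∶⟨ Γ ⊢ U₂ ⟩ → M ∶⟨ Γ ⊢ U₁ ⊓ U₂ ⟩
  e-ty : ∀ {Γ M K j} {U : TyU K} →
         M ∶⟨ Γ ⊢ U ⟩ → lift j M ∶⟨ ēEnv j Γ ⊢ ē j U ⟩
  ⊑-ty : ∀ {Γ Γ' M K} {U U' : TyU K} →
         M ∶⟨ Γ ⊢ U ⟩ → U ⊑ U' → Γ' ⊑E Γ → M ∶⟨ Γ' ⊢ U' ⟩

module Submission where

-- In any derivation M : ⟨ Γ ⊢ U ⟩ the domain of Γ is exactly
--     fv(M) (lemmas fv⊆dom and undefined-outside-fv).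
--   * Components.  Every type U of degree K is ≈ to ē_K T₁ ⊓ … ⊓ ē_K Tₙ ⊓ ω^K,
--     where T₁ … Tₙ are its 𝕋-components (normal-form); subtyping U ⊑ U' is
--     reflected on components: each component of U' is above, in the
--     componentwise order _≼_, some component of U (⊑⇒covers).
--   * Inversion.  By induction on derivations: a variable is typed from a
--     single declaration (var-inversion); every component of a type of an
--     abstraction is an arrow obtained by (→I) or (→I') and expanded
--     (lam-inversion); every component of a 𝕋-type of an application is
--     obtained by (→E) up to subsumption (app-inversion).
-- Parts (2) and (3) follow by combining lam-inversion with the normal form
-- (arrow-decomposition) and using the domain lemma to rule out the rule that
-- does not fit; part (4) combines app-inversion with var-inversion.

open import Defs
open import Data.Nat using (ℕ; zero; suc; _≟_)
open import Data.List using (List; []; _∷_; _++_; length; lookup)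
open import Data.List.Properties using (++-assoc)
open import Data.List.Membership.Propositional using (_∈_; _∉_)
open import Data.List.Membership.Propositional.Properties
  using (∈-++⁺ˡ; ∈-++⁺ʳ; ∈-++⁻; ∈-filter⁺; ∈-filter⁻; ∈-lookup)
open import Data.List.Membership.DecPropositional _≟IV_ using (_∈?_)
open import Data.List.Relation.Unary.Any using (here)
open import Data.List.Relation.Binary.Subset.Propositional using (_⊆_)
open import Data.List.Relation.Binary.Subset.Propositional.Properties
  using (⊆-reflexive; ⊆-reflexive-↭; xs⊆xs++ys)
open import Data.List.Relation.Binary.Permutation.Propositional.Properties
  using (++-comm)
open import Data.Fin using (Fin)
import Data.Fin as Fin
open import Data.Maybe using (Maybe; just; nothing; Is-just)
import Data.Maybe as Maybe
open import Data.Maybe.Relation.Unary.Any using (just)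
open import Data.Maybe.Relation.Binary.Pointwise using (Pointwise; just; nothing)
import Data.Maybe.Relation.Binary.Pointwise as Pointwise
open import Data.Product using (Σ; ∃-syntax; _×_; _,_; proj₁; proj₂)
open import Data.Sum using (_⊎_; inj₁; inj₂; [_,_]′; map₂)
open import Data.Unit using (tt)
open import Data.Empty using (⊥-elim)
open import Data.Bool using (if_then_else_)
open import Function using (id; _∘_)
open import Relation.Nullary using (¬_; Dec; yes; no; does; ¬?)
open import Relation.Nullary.Decidable using (dec-true; dec-false)
open import Relation.Binary.PropositionalEquality
  using (_≡_; _≢_; refl; sym; trans; cong; subst; module ≡-Reasoning)

-- A conditional on a decision reduces to the branch that the decided
-- proposition selects; all lookups in Defs' environments are such conditionals.
if-yes : ∀ {P A : Set} (p? : Dec P) {a b : A} → P → (if does p? then a else b) ≡ a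
if-yes p? p rewrite dec-true p? p = refl

if-no : ∀ {P A : Set} (p? : Dec P) {a b : A} → ¬ P → (if does p? then a else b) ≡ b
if-no p? ¬p rewrite dec-false p? ¬p = refl

,,-here : ∀ Γ w u → (Γ ,, w ↦ u) w ≡ just u
,,-here Γ w u = if-yes (w ≟IV w) refl

,,-there : ∀ Γ w u {v} → v ≢ w → (Γ ,, w ↦ u) v ≡ Γ v
,,-there Γ w u {v} v≢w = if-no (v ≟IV w) v≢w

↦-here : ∀ w u → [ w ↦ u ] w ≡ just u
↦-here w u = if-yes (w ≟IV w) refl

↦-there : ∀ w u {v} → v ≢ w → [ w ↦ u ] v ≡ nothing
↦-there w u {v} v≢w = if-no (v ≟IV w) v≢w

nothing-∉dom : ∀ {A : Set} {m : Maybe A} → m ≡ nothing → ¬ Is-just m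
nothing-∉dom refl ()

Is-just-map : ∀ {A B : Set} (f : A → B) {m : Maybe A} → Is-just m → Is-just (Maybe.map f m)
Is-just-map f (just t) = just t

pointwise-≡ : ∀ {R : Entry → Entry → Set} {m m' n n'} →
              m ≡ m' → n ≡ n' → Pointwise R m' n' → Pointwise R m n
pointwise-≡ refl refl r = r

below-nothing : ∀ {R : Entry → Entry → Set} {m n} → Pointwise R m n → n ≡ nothing → m ≡ nothing
below-nothing nothing refl = refl

below-defined : ∀ {R : Entry → Entry → Set} {m n} → Pointwise R m n → Is-just n → Is-just m
below-defined (just _) _ = just tt

⊑-refl : ∀ {L} {U : TyU L} → U ⊑ U
⊑-refl = ⊑-≈ ≈-refl

⊑E-refl : ∀ {Γ} → Γ ⊑E Γ
⊑E-refl v = Pointwise.refl (λ { {_ , _} → le ⊑-refl })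

⊑E-trans : ∀ {Γ Δ Θ} → Γ ⊑E Δ → Δ ⊑E Θ → Γ ⊑E Θ
⊑E-trans Γ⊑Δ Δ⊑Θ v = Pointwise.trans (λ { (le p) (le q) → le (⊑-trans p q) }) (Γ⊑Δ v) (Δ⊑Θ v)

≡⇒⊑E : ∀ {Γ Δ} → (∀ v → Γ v ≡ Δ v) → Γ ⊑E Δ
≡⇒⊑E {Δ = Δ} Γ≡Δ v = pointwise-≡ (Γ≡Δ v) refl (⊑E-refl {Δ} v)

,,-mono : ∀ {Γ' Γ} w {L} {U' U : TyU L} → Γ' ⊑E Γ → U' ⊑ U →
          (Γ' ,, w ↦ (L , U')) ⊑E (Γ ,, w ↦ (L , U))
,,-mono w Γ'⊑Γ U'⊑U v with v ≟IV w
... | yes refl = just (le U'⊑U)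
... | no _     = Γ'⊑Γ v

meet-nothingˡ : ∀ {m₁ m₂ m} → m₁ ≡ nothing → MeetEntry m₁ m₂ m → m ≡ m₂
meet-nothingˡ refl none  = refl
meet-nothingˡ refl right = refl

meet-nothingʳ : ∀ {m₁ m₂ m} → m₂ ≡ nothing → MeetEntry m₁ m₂ m → m ≡ m₁
meet-nothingʳ refl none = refl
meet-nothingʳ refl left = refl

meet-definedˡ : ∀ {m₁ m₂ m} → MeetEntry m₁ m₂ m → Is-just m₁ → Is-just m
meet-definedˡ left  _ = just tt
meet-definedˡ both  _ = just tt

meet-definedʳ : ∀ {m₁ m₂ m} → MeetEntry m₁ m₂ m → Is-just m₂ → Is-just m
meet-definedʳ right _ = just tt
meet-definedʳ both  _ = just tt

SingletonEnv : Env → IVar → Entry → Set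
SingletonEnv Γ w u = Γ w ≡ just u × (∀ {v} → v ≢ w → Γ v ≡ nothing)

singleton-[↦] : ∀ w u → SingletonEnv [ w ↦ u ] w u
singleton-[↦] w u = ↦-here w u , ↦-there w u

singleton-≈E : ∀ {Γ w K} {V : TyU K} → SingletonEnv Γ w (K , V) → Γ ≈E [ w ↦ (K , V) ]
singleton-≈E {w = w} (at , off) v with v ≟IV w
... | yes refl = pointwise-≡ at refl (just (eq ≈-refl))
... | no v≢w   = pointwise-≡ (off v≢w) refl nothing

singleton-unique : ∀ {Γ w K} {V V' : TyU K} →
                   SingletonEnv Γ w (K , V) → SingletonEnv Γ w (K , V') → V ≡ V'
singleton-unique (at , _) (at' , _) with trans (sym at) at'
... | refl = refl

below-just : ∀ {m K} {V : TyU K} → Pointwise EntryLE m (just (K , V)) →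
             ∃[ V' ] m ≡ just (K , V') × V' ⊑ V
below-just (just (le V'⊑V)) = _ , refl , V'⊑V

singleton-below : ∀ {Γ' Γ w K} {V : TyU K} → Γ' ⊑E Γ → SingletonEnv Γ w (K , V) →
                  ∃[ V' ] SingletonEnv Γ' w (K , V') × V' ⊑ V
singleton-below {Γ'} {w = w} Γ'⊑Γ (at , off)
  with below-just (subst (Pointwise EntryLE (Γ' w)) at (Γ'⊑Γ w))
... | V' , at' , V'⊑V = V' , (at' , λ v≢w → below-nothing (Γ'⊑Γ _) (off v≢w)) , V'⊑V

envω-var : ∀ x L → SingletonEnv (envω (var x L)) (x , L) (L , ω L)
envω-var x L = if-yes ((x , L) ∈? fv (var x L)) (here refl) , off
  where
  off : ∀ {v} → v ≢ (x , L) → envω (var x L) v ≡ nothing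
  off {y , K} v≢w = if-no ((y , K) ∈? fv (var x L)) λ { (here v≡w) → v≢w v≡w }

ē-entry : ℕ → Entry → Entry
ē-entry j (L , U) = j ∷ L , ē j U

data ēView (j : ℕ) : IVar → Set where
  lifted   : ∀ y L → ēView j (y , j ∷ L)
  unlifted : ∀ y K → (∀ {L} → K ≢ j ∷ L) → ēView j (y , K)

ē-view : ∀ j v → ēView j v
ē-view j (y , [])    = unlifted y [] λ ()
ē-view j (y , k ∷ L) with k ≟ j
... | yes refl = lifted y L
... | no k≢j   = unlifted y (k ∷ L) λ { refl → k≢j refl }

ēEnv-lifted : ∀ j Γ y L → ēEnv j Γ (y , j ∷ L) ≡ Maybe.map (ē-entry j) (Γ (y , L))
ēEnv-lifted j Γ y L = if-yes (j ≟ j) refl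

ēEnv-unlifted : ∀ j Γ y K → (∀ {L} → K ≢ j ∷ L) → ēEnv j Γ (y , K) ≡ nothing
ēEnv-unlifted j Γ y []      _   = refl
ēEnv-unlifted j Γ y (k ∷ L) K≢ = if-no (k ≟ j) λ { refl → K≢ refl }

ēEnv-singleton : ∀ j {Γ x L K} {V : TyU K} → SingletonEnv Γ (x , L) (K , V) →
                 SingletonEnv (ēEnv j Γ) (x , j ∷ L) (j ∷ K , ē j V)
ēEnv-singleton j {Γ} {x} {L} (at , off) = at' , off'
  where
  at' : ēEnv j Γ (x , j ∷ L) ≡ just (ē-entry j _)
  at' = trans (ēEnv-lifted j Γ x L) (cong (Maybe.map (ē-entry j)) at)
  off' : ∀ {v} → v ≢ (x , j ∷ L) → ēEnv j Γ v ≡ nothing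
  off' {v} v≢w with ē-view j v
  ... | lifted y L'         = trans (ēEnv-lifted j Γ y L')
                                    (cong (Maybe.map (ē-entry j)) (off λ { refl → v≢w refl }))
  ... | unlifted y K' K'≢ = ēEnv-unlifted j Γ y K' K'≢

ēEnv-,, : ∀ j Γ x L u v → (ēEnv j Γ ,, (x , j ∷ L) ↦ ē-entry j u) v ≡ ēEnv j (Γ ,, (x , L) ↦ u) v
ēEnv-,, j Γ x L u v = by-view (ē-view j v)
  where
  open ≡-Reasoning
  Γ⁺ ēΓ⁺ : Env
  Γ⁺  = Γ ,, (x , L) ↦ u
  ēΓ⁺ = ēEnv j Γ ,, (x , j ∷ L) ↦ ē-entry j u

  lifted-case : ∀ y L' → Dec ((y , L') ≡ (x , L)) → ēΓ⁺ (y , j ∷ L') ≡ ēEnv j Γ⁺ (y , j ∷ L')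
  lifted-case _ _ (yes refl) = begin
    ēΓ⁺ (x , j ∷ L)                     ≡⟨ ,,-here (ēEnv j Γ) (x , j ∷ L) (ē-entry j u) ⟩
    just (ē-entry j u)                  ≡⟨ cong (Maybe.map (ē-entry j)) (,,-here Γ (x , L) u) ⟨
    Maybe.map (ē-entry j) (Γ⁺ (x , L))  ≡⟨ ēEnv-lifted j Γ⁺ x L ⟨
    ēEnv j Γ⁺ (x , j ∷ L)               ∎
  lifted-case y L' (no y≢x) = begin
    ēΓ⁺ (y , j ∷ L')                    ≡⟨ ,,-there (ēEnv j Γ) (x , j ∷ L) (ē-entry j u) (λ { refl → y≢x refl }) ⟩
    ēEnv j Γ (y , j ∷ L')               ≡⟨ ēEnv-lifted j Γ y L' ⟩
    Maybe.map (ē-entry j) (Γ (y , L'))  ≡⟨ cong (Maybe.map (ē-entry j)) (,,-there Γ (x , L) u y≢x) ⟨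
    Maybe.map (ē-entry j) (Γ⁺ (y , L')) ≡⟨ ēEnv-lifted j Γ⁺ y L' ⟨
    ēEnv j Γ⁺ (y , j ∷ L')              ∎

  by-view : ∀ {v} → ēView j v → ēΓ⁺ v ≡ ēEnv j Γ⁺ v
  by-view (lifted y L')     = lifted-case y L' ((y , L') ≟IV (x , L))
  by-view (unlifted y K K≢) = begin
    ēΓ⁺ (y , K)       ≡⟨ ,,-there (ēEnv j Γ) (x , j ∷ L) (ē-entry j u) {y , K} (λ { refl → K≢ refl }) ⟩
    ēEnv j Γ (y , K)  ≡⟨ ēEnv-unlifted j Γ y K K≢ ⟩
    nothing           ≡⟨ ēEnv-unlifted j Γ⁺ y K K≢ ⟨
    ēEnv j Γ⁺ (y , K) ∎

fv-lam⁺ : ∀ x L M {v} → v ∈ fv M → v ≢ (x , L) → v ∈ fv (lam x L M)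
fv-lam⁺ x L M = ∈-filter⁺ (λ w → ¬? (w ≟IV (x , L)))

fv-lam⁻ : ∀ x L M {v} → v ∈ fv (lam x L M) → v ∈ fv M × v ≢ (x , L)
fv-lam⁻ x L M = ∈-filter⁻ (λ w → ¬? (w ≟IV (x , L))) {xs = fv M}

lam-binds : ∀ x L M → (x , L) ∉ fv (lam x L M)
lam-binds x L M x∈ = proj₂ (fv-lam⁻ x L M x∈) refl

fv-lift⁺ : ∀ j M {y L} → (y , L) ∈ fv M → (y , j ∷ L) ∈ fv (lift j M)
fv-lift⁺ j (var x L)   (here refl) = here refl
fv-lift⁺ j (app M N)   y∈ with ∈-++⁻ (fv M) y∈
... | inj₁ y∈M = ∈-++⁺ˡ (fv-lift⁺ j M y∈M)
... | inj₂ y∈N = ∈-++⁺ʳ (fv (lift j M)) (fv-lift⁺ j N y∈N)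
fv-lift⁺ j (lam x L M) y∈ with fv-lam⁻ x L M y∈
... | y∈M , y≢x = fv-lam⁺ x (j ∷ L) (lift j M) (fv-lift⁺ j M y∈M) λ { refl → y≢x refl }

fv-lift⁻ : ∀ j M {y K} → (y , K) ∈ fv (lift j M) → ∃[ L ] K ≡ j ∷ L × (y , L) ∈ fv M
fv-lift⁻ j (var x L)   (here refl) = L , refl , here refl
fv-lift⁻ j (app M N)   y∈ with ∈-++⁻ (fv (lift j M)) y∈
... | inj₁ y∈M = let L , K≡ , y∈ = fv-lift⁻ j M y∈M in L , K≡ , ∈-++⁺ˡ y∈
... | inj₂ y∈N = let L , K≡ , y∈ = fv-lift⁻ j N y∈N in L , K≡ , ∈-++⁺ʳ (fv M) y∈
fv-lift⁻ j (lam x L M) y∈ with fv-lam⁻ x (j ∷ L) (lift j M) y∈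
... | y∈M , y≢x with fv-lift⁻ j M y∈M
...   | L' , refl , y∈ = L' , refl , fv-lam⁺ x L M y∈ λ { refl → y≢x refl }

fv⊆dom : ∀ {K Γ M} {U : TyU K} → M ∶⟨ Γ ⊢ U ⟩ → ∀ {v} → v ∈ fv M → v ∈dom Γ
fv⊆dom (ax x T) (here refl) = subst Is-just (sym (↦-here (x , []) _)) (just tt)
fv⊆dom (ω-ty {M} _) {y , K} y∈ = subst Is-just (sym (if-yes ((y , K) ∈? fv M) y∈)) (just tt)
fv⊆dom (→I {Γ} {x} {L} {M} _ D _) v∈ with fv-lam⁻ x L M v∈
... | v∈M , v≢x = subst Is-just (,,-there Γ (x , L) _ v≢x) (fv⊆dom D v∈M)
fv⊆dom (→I' {x = x} {L} {M} D _ _) v∈ = fv⊆dom D (proj₁ (fv-lam⁻ x L M v∈))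
fv⊆dom (→E {M₁ = M₁} D₁ D₂ _ Γ₁⊓Γ₂ _) {v} v∈ with ∈-++⁻ (fv M₁) v∈
... | inj₁ v∈M₁ = meet-definedˡ (Γ₁⊓Γ₂ v) (fv⊆dom D₁ v∈M₁)
... | inj₂ v∈M₂ = meet-definedʳ (Γ₁⊓Γ₂ v) (fv⊆dom D₂ v∈M₂)
fv⊆dom (⊓I D _) = fv⊆dom D
fv⊆dom (e-ty {Γ} {M} {j = j} D) {y , _} v∈ with fv-lift⁻ j M v∈
... | L , refl , y∈M = subst Is-just (sym (ēEnv-lifted j Γ y L)) (Is-just-map (ē-entry j) (fv⊆dom D y∈M))
fv⊆dom (⊑-ty D _ Γ'⊑Γ) {v} v∈ = below-defined (Γ'⊑Γ v) (fv⊆dom D v∈)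

undefined-outside-fv : ∀ {K Γ M} {U : TyU K} → M ∶⟨ Γ ⊢ U ⟩ → ∀ {v} → v ∉ fv M → Γ v ≡ nothing
undefined-outside-fv (ax x T) v∉ = ↦-there (x , []) _ λ v≡x → v∉ (here v≡x)
undefined-outside-fv (ω-ty {M} _) {y , K} v∉ = if-no ((y , K) ∈? fv M) v∉
undefined-outside-fv (→I {Γ} {x} {L} {M} x∉Γ D _) {v} v∉ with v ≟IV (x , L)
... | yes refl = x∉Γ
... | no v≢x   = trans (sym (,,-there Γ (x , L) _ v≢x))
                       (undefined-outside-fv D λ v∈M → v∉ (fv-lam⁺ x L M v∈M v≢x))
undefined-outside-fv (→I' {x = x} {L} {M} D x∉Γ _) {v} v∉ with v ≟IV (x , L)
... | yes refl = x∉Γ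
... | no v≢x   = undefined-outside-fv D λ v∈M → v∉ (fv-lam⁺ x L M v∈M v≢x)
undefined-outside-fv (→E {M₁ = M₁} D₁ D₂ _ Γ₁⊓Γ₂ _) {v} v∉ =
  trans (meet-nothingˡ (undefined-outside-fv D₁ (v∉ ∘ ∈-++⁺ˡ)) (Γ₁⊓Γ₂ v))
        (undefined-outside-fv D₂ (v∉ ∘ ∈-++⁺ʳ (fv M₁)))
undefined-outside-fv (⊓I D _) = undefined-outside-fv D
undefined-outside-fv (e-ty {Γ} {M} {j = j} D) {v} v∉ with ē-view j v
... | lifted y L      = trans (ēEnv-lifted j Γ y L)
                              (cong (Maybe.map (ē-entry j)) (undefined-outside-fv D (v∉ ∘ fv-lift⁺ j M)))
... | unlifted y K K≢ = ēEnv-unlifted j Γ y K K≢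
undefined-outside-fv (⊑-ty D _ Γ'⊑Γ) {v} v∉ = below-nothing (Γ'⊑Γ v) (undefined-outside-fv D v∉)

-- The 𝕋-components of a type: U is (≈) the intersection of their expansions.
components : ∀ {L} → TyU L → List TyT
components (embed T) = T ∷ []
components (ω L)     = []
components (U ⊓ V)   = components U ++ components V
components (ē i U)   = components U

data _≼_ : TyT → TyT → Set where
  atom≼ : ∀ {a} → atom a ≼ atom a
  arrow≼ : ∀ {L} {U₁ U₂ : TyU L} {T₁ T₂} → U₂ ⊑ U₁ → embed T₁ ⊑ embed T₂ → (U₁ ⇒ T₁) ≼ (U₂ ⇒ T₂)

≼-refl : ∀ {T} → T ≼ T
≼-refl {atom _} = atom≼
≼-refl {_ ⇒ _}  = arrow≼ ⊑-refl ⊑-refl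

≼-trans : ∀ {T₁ T₂ T₃} → T₁ ≼ T₂ → T₂ ≼ T₃ → T₁ ≼ T₃
≼-trans atom≼ atom≼ = atom≼
≼-trans (arrow≼ U₂⊑U₁ T₁⊑T₂) (arrow≼ U₃⊑U₂ T₂⊑T₃) = arrow≼ (⊑-trans U₃⊑U₂ U₂⊑U₁) (⊑-trans T₁⊑T₂ T₂⊑T₃)

≼⇒⊑ : ∀ {T T'} → T ≼ T' → embed T ⊑ embed T'
≼⇒⊑ atom≼            = ⊑-refl
≼⇒⊑ (arrow≼ U⊑ T⊑) = ⊑-⇒ U⊑ T⊑

≈T⇒≼ : ∀ {T T'} → T ≈T T' → T ≼ T' × T' ≼ T
≈T⇒≼ ≈T-refl          = ≼-refl , ≼-refl
≈T⇒≼ (≈T-sym p)       = proj₂ (≈T⇒≼ p) , proj₁ (≈T⇒≼ p)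
≈T⇒≼ (≈T-trans p q)   = ≼-trans (proj₁ (≈T⇒≼ p)) (proj₁ (≈T⇒≼ q))
                      , ≼-trans (proj₂ (≈T⇒≼ q)) (proj₂ (≈T⇒≼ p))
≈T⇒≼ (≈T-⇒ U≈U' T≈T') = arrow≼ (⊑-≈ (≈-sym U≈U')) (⊑-≈ (≈-embed T≈T'))
                      , arrow≼ (⊑-≈ U≈U') (⊑-≈ (≈-embed (≈T-sym T≈T')))

Covers : List TyT → List TyT → Set
Covers Ts Ts' = ∀ {T'} → T' ∈ Ts' → ∃[ T ] T ∈ Ts × T ≼ T'

covers-⊇ : ∀ {Ts Ts'} → Ts' ⊆ Ts → Covers Ts Ts'
covers-⊇ Ts'⊆Ts T'∈ = _ , Ts'⊆Ts T'∈ , ≼-refl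

covers-trans : ∀ {Ts₁ Ts₂ Ts₃} → Covers Ts₁ Ts₂ → Covers Ts₂ Ts₃ → Covers Ts₁ Ts₃
covers-trans c₁₂ c₂₃ T₃∈ with c₂₃ T₃∈
... | T₂ , T₂∈ , T₂≼T₃ with c₁₂ T₂∈
...   | T₁ , T₁∈ , T₁≼T₂ = T₁ , T₁∈ , ≼-trans T₁≼T₂ T₂≼T₃

covers-++ : ∀ {Ts₁ Ts₁' Ts₂ Ts₂'} → Covers Ts₁ Ts₁' → Covers Ts₂ Ts₂' →
            Covers (Ts₁ ++ Ts₂) (Ts₁' ++ Ts₂')
covers-++ {Ts₁} {Ts₁'} c₁ c₂ T'∈ with ∈-++⁻ Ts₁' T'∈
... | inj₁ T'∈₁ = let T , T∈ , T≼T' = c₁ T'∈₁ in T , ∈-++⁺ˡ T∈ , T≼T'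
... | inj₂ T'∈₂ = let T , T∈ , T≼T' = c₂ T'∈₂ in T , ∈-++⁺ʳ Ts₁ T∈ , T≼T'

≈⇒covers : ∀ {L} {U V : TyU L} → U ≈U V →
           Covers (components U) (components V) × Covers (components V) (components U)
≈⇒covers ≈-refl        = covers-⊇ id , covers-⊇ id
≈⇒covers (≈-sym p)     = proj₂ (≈⇒covers p) , proj₁ (≈⇒covers p)
≈⇒covers (≈-trans p q) = covers-trans (proj₁ (≈⇒covers p)) (proj₁ (≈⇒covers q))
                       , covers-trans (proj₂ (≈⇒covers q)) (proj₂ (≈⇒covers p))
≈⇒covers (≈-comm {U₁ = U₁} {U₂}) =
  covers-⊇ (⊆-reflexive-↭ (++-comm (components U₂) (components U₁)))
  , covers-⊇ (⊆-reflexive-↭ (++-comm (components U₁) (components U₂)))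
≈⇒covers (≈-assoc {U₁ = U₁} {U₂} {U₃}) =
  covers-⊇ (⊆-reflexive (sym (++-assoc (components U₁) (components U₂) (components U₃))))
  , covers-⊇ (⊆-reflexive (++-assoc (components U₁) (components U₂) (components U₃)))
≈⇒covers (≈-idem {U = U}) =
  covers-⊇ (xs⊆xs++ys (components U) (components U)) , covers-⊇ ([ id , id ]′ ∘ ∈-++⁻ (components U))
≈⇒covers ≈-ē-⊓         = covers-⊇ id , covers-⊇ id
≈⇒covers ≈-ω-unit      = covers-⊇ id , covers-⊇ id
≈⇒covers ≈-ē-ω         = covers-⊇ id , covers-⊇ id
≈⇒covers (≈-⊓ p q)     = covers-++ (proj₁ (≈⇒covers p)) (proj₁ (≈⇒covers q))
                       , covers-++ (proj₂ (≈⇒covers p)) (proj₂ (≈⇒covers q))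
≈⇒covers (≈-ē p)       = ≈⇒covers p
≈⇒covers (≈-embed t)   = (λ { (here refl) → _ , here refl , proj₁ (≈T⇒≼ t) })
                       , (λ { (here refl) → _ , here refl , proj₂ (≈T⇒≼ t) })

⊑⇒covers : ∀ {L} {U V : TyU L} → U ⊑ V → Covers (components U) (components V)
⊑⇒covers (⊑-≈ p)               = proj₁ (≈⇒covers p)
⊑⇒covers (⊑-trans p q)         = covers-trans (⊑⇒covers p) (⊑⇒covers q)
⊑⇒covers (⊑-⊓ˡ {U₁ = U₁} {U₂}) = covers-⊇ (xs⊆xs++ys (components U₁) (components U₂))
⊑⇒covers (⊑-⊓ p q)             = covers-++ (⊑⇒covers p) (⊑⇒covers q)
⊑⇒covers (⊑-⇒ U⊑ T⊑)           = λ { (here refl) → _ , here refl , arrow≼ U⊑ T⊑ }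
⊑⇒covers (⊑-ē p)               = ⊑⇒covers p

⋂ᶜ : (K : Index) → List TyT → TyU K
⋂ᶜ K []       = ω K
⋂ᶜ K (T ∷ Ts) = ēT K T ⊓ ⋂ᶜ K Ts

⊓ω-unit : ∀ {L} {U : TyU L} → (U ⊓ ω L) ≈U U
⊓ω-unit = ≈-trans ≈-comm ≈-ω-unit

⋂ᶜ-++ : ∀ K Ts Ts' → ⋂ᶜ K (Ts ++ Ts') ≈U (⋂ᶜ K Ts ⊓ ⋂ᶜ K Ts')
⋂ᶜ-++ K []       Ts' = ≈-sym ≈-ω-unit
⋂ᶜ-++ K (T ∷ Ts) Ts' = ≈-trans (≈-⊓ ≈-refl (⋂ᶜ-++ K Ts Ts')) (≈-sym ≈-assoc)

⋂ᶜ-ē : ∀ i K Ts → ē i (⋂ᶜ K Ts) ≈U ⋂ᶜ (i ∷ K) Ts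
⋂ᶜ-ē i K []       = ≈-ē-ω
⋂ᶜ-ē i K (T ∷ Ts) = ≈-trans ≈-ē-⊓ (≈-⊓ ≈-refl (⋂ᶜ-ē i K Ts))

normal-form : ∀ {K} (U : TyU K) → U ≈U ⋂ᶜ K (components U)
normal-form (embed T) = ≈-sym ⊓ω-unit
normal-form (ω L)     = ≈-refl
normal-form {K} (U ⊓ V) = ≈-trans (≈-⊓ (normal-form U) (normal-form V))
                                  (≈-sym (⋂ᶜ-++ K (components U) (components V)))
normal-form (ē i U) = ≈-trans (≈-ē (normal-form U)) (⋂ᶜ-ē i _ (components U))

⋂ᶜ-as-⋂ : ∀ K T Ts → ⋂ᶜ K (T ∷ Ts) ≈U ⋂ (length Ts) (λ i → ēT K (lookup (T ∷ Ts) i))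
⋂ᶜ-as-⋂ K T []        = ⊓ω-unit
⋂ᶜ-as-⋂ K T (T' ∷ Ts) = ≈-⊓ ≈-refl (⋂ᶜ-as-⋂ K T' Ts)

⋂-cong : ∀ {K} n {f g : Fin (suc n) → TyU K} → (∀ i → f i ≡ g i) → ⋂ n f ≈U ⋂ n g
⋂-cong zero    f≡g rewrite f≡g Fin.zero = ≈-refl
⋂-cong (suc n) f≡g rewrite f≡g Fin.zero = ≈-⊓ ≈-refl (⋂-cong n (f≡g ∘ Fin.suc))

record ArrowWith (P : ∀ {L} → TyU L → TyT → Set) (T : TyT) : Set where
  constructor arrow
  field
    degree   : Index
    domain   : TyU degree
    codomain : TyT
    shape    : T ≡ domain ⇒ codomain
    property : P domain codomain

arrowWith-map : ∀ {P Q : ∀ {L} → TyU L → TyT → Set} →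
                (∀ {L} {V : TyU L} {T} → P V T → Q V T) → ∀ {T} → ArrowWith P T → ArrowWith Q T
arrowWith-map f (arrow L V T shape p) = arrow L V T shape (f p)

Decomposition : ∀ {K} → TyU K → (∀ {L} → TyU L → TyT → Set) → Set
Decomposition {K} U P =
  (U ≈U ω K)
  ⊎ Σ ℕ λ n → Σ (Fin (suc n) → Index) λ Ls →
    Σ ((i : Fin (suc n)) → TyU (Ls i)) λ V → Σ (Fin (suc n) → TyT) λ T →
      (U ≈U ⋂ n (λ i → ēT K (V i ⇒ T i))) × (∀ i → P (V i) (T i))

arrow-decomposition : ∀ {K} (U : TyU K) {P : ∀ {L} → TyU L → TyT → Set} →
                      (∀ {T} → T ∈ components U → ArrowWith P T) → Decomposition U P
arrow-decomposition {K} U arrows with components U | normal-form U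
... | []     | U≈ω = inj₁ U≈ω
... | T ∷ Ts | U≈⋂ =
  inj₂ (length Ts , degree ∘ a , domain ∘ a , codomain ∘ a ,
        ≈-trans U≈⋂ (≈-trans (⋂ᶜ-as-⋂ K T Ts) (⋂-cong (length Ts) (cong (ēT K) ∘ shape ∘ a))) ,
        property ∘ a)
  where
  open ArrowWith
  a : ∀ i → ArrowWith _ (lookup (T ∷ Ts) i)
  a i = arrows (∈-lookup i)

lift-var⁻ : ∀ j M {x L} → lift j M ≡ var x L → ∃[ L' ] M ≡ var x L' × L ≡ j ∷ L'
lift-var⁻ j (var x L') refl = L' , refl , refl

lift-lam⁻ : ∀ j M {x L N} → lift j M ≡ lam x L N →
            ∃[ L' ] ∃[ N' ] M ≡ lam x L' N' × L ≡ j ∷ L' × N ≡ lift j N'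
lift-lam⁻ j (lam x L' N') refl = L' , N' , refl , refl , refl

ēU-mono : ∀ K {L} {U V : TyU L} → U ⊑ V → ēU K U ⊑ ēU K V
ēU-mono []      U⊑V = U⊑V
ēU-mono (i ∷ K) U⊑V = ⊑-ē (ēU-mono K U⊑V)

ēT-mono : ∀ K {T T'} → embed T ⊑ embed T' → ēT K T ⊑ ēT K T'
ēT-mono []      T⊑T' = T⊑T'
ēT-mono (i ∷ K) T⊑T' = ⊑-ē (ēT-mono K T⊑T')

var-inversion : ∀ {K Γ M x L} {U : TyU K} → M ∶⟨ Γ ⊢ U ⟩ → M ≡ var x L →
                ∃[ V ] SingletonEnv Γ (x , L) (K , V) × V ⊑ U
var-inversion (ax x T) refl = embed T , singleton-[↦] (x , []) _ , ⊑-refl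
var-inversion (ω-ty {var x L} _) refl = ω L , envω-var x L , ⊑-refl
var-inversion (⊓I D₁ D₂) refl with var-inversion D₁ refl | var-inversion D₂ refl
... | V₁ , Γ≐V₁ , V₁⊑U₁ | V₂ , Γ≐V₂ , V₂⊑U₂ rewrite singleton-unique Γ≐V₁ Γ≐V₂ =
  V₂ , Γ≐V₂ , ⊑-trans (⊑-≈ (≈-sym ≈-idem)) (⊑-⊓ V₁⊑U₁ V₂⊑U₂)
var-inversion (e-ty {M = M} {j = j} D) M⁺≡x with lift-var⁻ j M M⁺≡x
... | _ , refl , refl with var-inversion D refl
...   | V , Γ≐V , V⊑U = ē j V , ēEnv-singleton j Γ≐V , ⊑-ē V⊑U
var-inversion (⊑-ty D U⊑U' Γ'⊑Γ) M≡x with var-inversion D M≡x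
... | V , Γ≐V , V⊑U with singleton-below Γ'⊑Γ Γ≐V
...   | V' , Γ'≐V' , V'⊑V = V' , Γ'≐V' , ⊑-trans V'⊑V (⊑-trans V⊑U U⊑U')

-- The premise of (→I) resp. (→I') for λx^L.M with conclusion V → T, expanded by ē_K.
LamBody : Env → ℕ → Index → Term → (K : Index) → ∀ {L'} → TyU L' → TyT → Set
LamBody Γ x L M K {L'} V T =
  (Γ (x , L) ≡ nothing × M ∶⟨ Γ ,, (x , L) ↦ (K ++ L' , ēU K V) ⊢ ēT K T ⟩)
  ⊎ M ∶⟨ Γ ⊢ ēT K T ⟩

lamBody-ē : ∀ j {Γ x L M K L'} {V : TyU L'} {T} →
            LamBody Γ x L M K V T → LamBody (ēEnv j Γ) x (j ∷ L) (lift j M) (j ∷ K) V T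
lamBody-ē j {Γ} {x} {L} {K = K} {L'} {V} (inj₁ (x∉Γ , D)) =
  inj₁ ( trans (ēEnv-lifted j Γ x L) (cong (Maybe.map (ē-entry j)) x∉Γ)
       , ⊑-ty (e-ty D) ⊑-refl (≡⇒⊑E (ēEnv-,, j Γ x L (K ++ L' , ēU K V))))
lamBody-ē j (inj₂ D) = inj₂ (e-ty D)

lamBody-⊑ : ∀ {Γ' Γ x L M K T T'} → Γ' ⊑E Γ → T ≼ T' →
            ArrowWith (LamBody Γ x L M K) T → ArrowWith (LamBody Γ' x L M K) T'
lamBody-⊑ {K = K} Γ'⊑Γ (arrow≼ V'⊑V T⊑T') (arrow _ _ _ refl (inj₁ (x∉Γ , D))) =
  arrow _ _ _ refl (inj₁ ( below-nothing (Γ'⊑Γ _) x∉Γ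
                         , ⊑-ty D (ēT-mono K T⊑T') (,,-mono _ Γ'⊑Γ (ēU-mono K V'⊑V))))
lamBody-⊑ {K = K} Γ'⊑Γ (arrow≼ _ T⊑T') (arrow _ _ _ refl (inj₂ D)) =
  arrow _ _ _ refl (inj₂ (⊑-ty D (ēT-mono K T⊑T') Γ'⊑Γ))

lam-inversion : ∀ {K Γ N x L M} {U : TyU K} → N ∶⟨ Γ ⊢ U ⟩ → N ≡ lam x L M →
                ∀ {T} → T ∈ components U → ArrowWith (LamBody Γ x L M K) T
lam-inversion (→I x∉Γ D _) refl (here refl) = arrow _ _ _ refl (inj₁ (x∉Γ , D))
lam-inversion (→I' D _ _)  refl (here refl) = arrow _ _ _ refl (inj₂ D)
lam-inversion (⊓I {U₁ = U₁} D₁ D₂) N≡λ T∈ with ∈-++⁻ (components U₁) T∈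
... | inj₁ T∈₁ = lam-inversion D₁ N≡λ T∈₁
... | inj₂ T∈₂ = lam-inversion D₂ N≡λ T∈₂
lam-inversion (e-ty {M = N} {j = j} D) N⁺≡λ T∈ with lift-lam⁻ j N N⁺≡λ
... | _ , _ , refl , refl , refl = arrowWith-map (lamBody-ē j) (lam-inversion D refl T∈)
lam-inversion (⊑-ty D U⊑U' Γ'⊑Γ) N≡λ T'∈ with ⊑⇒covers U⊑U' T'∈
... | T , T∈ , T≼T' = lamBody-⊑ Γ'⊑Γ T≼T' (lam-inversion D N≡λ T∈)

record AppInversion (Δ : Env) (M₁ M₂ : Term) (T' : TyT) : Set where
  field
    {Γ₁ Γ₂ Θ}  : Env
    {argDegree} : Index
    {argType}  : TyU argDegree
    {result}   : TyT
    function   : M₁ ∶⟨ Γ₁ ⊢ embed (argType ⇒ result) ⟩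
    argument   : M₂ ∶⟨ Γ₂ ⊢ argType ⟩
    meet       : MeetEnv Γ₁ Γ₂ Θ
    env-⊑      : Δ ⊑E Θ
    result-⊑   : embed result ⊑ embed T'

app-inversion : ∀ {K Δ N M₁ M₂} {U : TyU K} → N ∶⟨ Δ ⊢ U ⟩ → K ≡ [] → N ≡ app M₁ M₂ →
                ∀ {T'} → T' ∈ components U → AppInversion Δ M₁ M₂ T'
app-inversion (→E D₁ D₂ _ Γ₁⊓Γ₂ _) _ refl (here refl) =
  record { function = D₁ ; argument = D₂ ; meet = Γ₁⊓Γ₂ ; env-⊑ = ⊑E-refl ; result-⊑ = ⊑-refl }
app-inversion (⊓I {U₁ = U₁} D₁ D₂) K≡∅ N≡app T∈ with ∈-++⁻ (components U₁) T∈
... | inj₁ T∈₁ = app-inversion D₁ K≡∅ N≡app T∈₁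
... | inj₂ T∈₂ = app-inversion D₂ K≡∅ N≡app T∈₂
app-inversion (⊑-ty D U⊑U' Δ'⊑Δ) K≡∅ N≡app T'∈ with ⊑⇒covers U⊑U' T'∈
... | T , T∈ , T≼T' =
  record { function = function ; argument = argument ; meet = meet
         ; env-⊑ = ⊑E-trans Δ'⊑Δ env-⊑ ; result-⊑ = ⊑-trans result-⊑ (≼⇒⊑ T≼T') }
  where open AppInversion (app-inversion D K≡∅ N≡app T∈)

var-generation : ∀ {K} x L (Γ : Env) (U : TyU K) → var x L ∶⟨ Γ ⊢ U ⟩ →
                 Σ (TyU K) λ V → (Γ ≈E [ (x , L) ↦ (K , V) ]) × (V ⊑ U)
var-generation x L Γ U D with var-inversion D refl
... | V , Γ≐V , V⊑U = V , singleton-≈E Γ≐V , V⊑U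

lam-generation-free : ∀ {K} x L M (Γ : Env) (U : TyU K) → lam x L M ∶⟨ Γ ⊢ U ⟩ → (x , L) ∈ fv M →
  (U ≈U ω K)
  ⊎ Σ ℕ λ n → Σ (Fin (suc n) → Index) λ Ls →
    Σ ((i : Fin (suc n)) → TyU (Ls i)) λ V → Σ (Fin (suc n) → TyT) λ T →
      (U ≈U ⋂ n (λ i → ēT K (V i ⇒ T i)))
      × (Γ (x , L) ≡ nothing)
      × (∀ i → M ∶⟨ Γ ,, (x , L) ↦ (K ++ Ls i , ēU K (V i)) ⊢ ēT K (T i) ⟩)
lam-generation-free {K} x L M Γ U D x∈M =
  map₂ (λ { (n , Ls , V , T , U≈⋂ , premises) → n , Ls , V , T , U≈⋂ , x∉Γ , premises })
       (arrow-decomposition U (arrowWith-map from-→I ∘ lam-inversion D refl))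
  where
  x∉Γ : Γ (x , L) ≡ nothing
  x∉Γ = undefined-outside-fv D (lam-binds x L M)
  -- (→I') does not apply: its premise types M in Γ, which does not declare x^L ∈ fv(M).
  from-→I : ∀ {L'} {V : TyU L'} {T} → LamBody Γ x L M K V T →
            M ∶⟨ Γ ,, (x , L) ↦ (K ++ L' , ēU K V) ⊢ ēT K T ⟩
  from-→I (inj₁ (_ , D')) = D'
  from-→I (inj₂ D')       = ⊥-elim (nothing-∉dom x∉Γ (fv⊆dom D' x∈M))

lam-generation-vacuous : ∀ {K} x L M (Γ : Env) (U : TyU K) → lam x L M ∶⟨ Γ ⊢ U ⟩ → (x , L) ∉ fv M →
                         Decomposition U (λ _ T → M ∶⟨ Γ ⊢ ēT K T ⟩)
lam-generation-vacuous {K} x L M Γ U D x∉M =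
  arrow-decomposition U (arrowWith-map from-→I' ∘ lam-inversion D refl)
  where
  -- (→I) does not apply: its premise declares x^L, so x^L would be free in M.
  from-→I' : ∀ {L'} {V : TyU L'} {T} → LamBody Γ x L M K V T → M ∶⟨ Γ ⊢ ēT K T ⟩
  from-→I' (inj₁ (_ , D')) with () ← trans (sym (,,-here Γ (x , L) _)) (undefined-outside-fv D' x∉M)
  from-→I' (inj₂ D')       = D'

eta-generation : ∀ {L'} M x L (Γ : Env) (U : TyU L') (T : TyT) → Γ (x , L) ≡ nothing →
                 app M (var x L) ∶⟨ Γ ,, (x , L) ↦ (L' , U) ⊢ embed T ⟩ → (x , L) ∉ fv M →
                 M ∶⟨ Γ ⊢ embed (U ⇒ T) ⟩
eta-generation {L'} M x L Γ U T x∉Γ D x∉M = ⊑-ty function arrow-⊑ Γ⊑Γ₁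
  where
  open AppInversion (app-inversion D refl refl (here refl))
  -- x^L is not free in M, so Γ₁ does not declare it ...
  x∉Γ₁ : Γ₁ (x , L) ≡ nothing
  x∉Γ₁ = undefined-outside-fv function x∉M
  -- ... while Γ₂ declares exactly x^L : V₂, with V₂ ⊑ argType.
  arg : ∃[ V ] SingletonEnv Γ₂ (x , L) (argDegree , V) × V ⊑ argType
  arg = var-inversion argument refl
  V₂ : TyU argDegree
  V₂ = proj₁ arg
  Γ₂≐V₂ : SingletonEnv Γ₂ (x , L) (argDegree , V₂)
  Γ₂≐V₂ = proj₁ (proj₂ arg)
  -- Hence U ⊑ V₂, read off at x^L from  Γ , x^L : U ⊑ Γ₁ ⊓ Γ₂.
  U⊑V₂ : Pointwise EntryLE (just (L' , U)) (just (argDegree , V₂))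
  U⊑V₂ = pointwise-≡ (sym (,,-here Γ (x , L) _))
                     (sym (trans (meet-nothingˡ x∉Γ₁ (meet (x , L))) (proj₁ Γ₂≐V₂)))
                     (env-⊑ (x , L))
  -- An entry x^L : U below x^L : V₂ forces equal degrees, and then V ⇒ R ⊑ U ⇒ T.
  ⇒-⊑ : ∀ {K} {V₂ V : TyU K} {R} → Pointwise EntryLE (just (L' , U)) (just (K , V₂)) →
        V₂ ⊑ V → embed R ⊑ embed T → embed (V ⇒ R) ⊑ embed (U ⇒ T)
  ⇒-⊑ (just (le U⊑V₂)) V₂⊑V R⊑T = ⊑-⇒ (⊑-trans U⊑V₂ V₂⊑V) R⊑T
  arrow-⊑ : embed (argType ⇒ result) ⊑ embed (U ⇒ T)
  arrow-⊑ = ⇒-⊑ U⊑V₂ (proj₂ (proj₂ arg)) result-⊑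
  -- Away from x^L, Γ₂ is undefined and Γ₁ ⊓ Γ₂ agrees with Γ₁.
  Γ⊑Γ₁ : Γ ⊑E Γ₁
  Γ⊑Γ₁ v with v ≟IV (x , L)
  ... | yes refl = pointwise-≡ x∉Γ x∉Γ₁ nothing
  ... | no v≢x   = pointwise-≡ (sym (,,-there Γ (x , L) _ v≢x))
                               (sym (meet-nothingʳ (proj₂ Γ₂≐V₂ v≢x) (meet v)))
                               (env-⊑ v)

lemma5 :
    -- (1)
    (∀ {K} x L (Γ : Env) (U : TyU K) →
       var x L ∶⟨ Γ ⊢ U ⟩ →
       Σ (TyU K) λ V → (Γ ≈E [ (x , L) ↦ (K , V) ]) × (V ⊑ U))
    ×
    -- (2)
    (∀ {K} x L M (Γ : Env) (U : TyU K) →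
       lam x L M ∶⟨ Γ ⊢ U ⟩ → (x , L) ∈ fv M →
       (U ≈U ω K)
       ⊎ Σ ℕ λ n → Σ (Fin (suc n) → Index) λ Ls →
         Σ ((i : Fin (suc n)) → TyU (Ls i)) λ V → Σ (Fin (suc n) → TyT) λ T →
           (U ≈U ⋂ n (λ i → ēT K (V i ⇒ T i)))
           × (Γ (x , L) ≡ nothing)
           × (∀ i → M ∶⟨ Γ ,, (x , L) ↦ (K ++ Ls i , ēU K (V i)) ⊢ ēT K (T i) ⟩))
    ×
    -- (3)
    (∀ {K} x L M (Γ : Env) (U : TyU K) →
       lam x L M ∶⟨ Γ ⊢ U ⟩ → (x , L) ∉ fv M →
       (U ≈U ω K)
       ⊎ Σ ℕ λ n → Σ (Fin (suc n) → Index) λ Ls →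
         Σ ((i : Fin (suc n)) → TyU (Ls i)) λ V → Σ (Fin (suc n) → TyT) λ T →
           (U ≈U ⋂ n (λ i → ēT K (V i ⇒ T i)))
           × (∀ i → M ∶⟨ Γ ⊢ ēT K (T i) ⟩))
    ×
    -- (4)
    (∀ {L'} M x L (Γ : Env) (U : TyU L') (T : TyT) →
       Γ (x , L) ≡ nothing →
       app M (var x L) ∶⟨ Γ ,, (x , L) ↦ (L' , U) ⊢ embed T ⟩ →
       (x , L) ∉ fv M →
       M ∶⟨ Γ ⊢ embed (U ⇒ T) ⟩)
lemma5 = var-generation , lam-generation-free , lam-generation-vacuous , eta-generation
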